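{- Every Nagata lattice and every restricted Nagata lattice $\mathbf N$ satisfies: for all $x,y\in N$, if $\sigma x\le\sigma y$ and $\gamma x\le\gamma y$, then $x\le y$.
   Context: For an idempotent isotone map $\gamma$ on a posemigroup $\mathbf N$ write $N_\gamma=\gamma[N]$. A pre-conucleus is an idempotent isotone $\sigma$ with $N_\sigma$ a subsemigroup; a $\sigma$-closure operator is an idempotent isotone $\gamma$ with $ax\le\gamma(ax)$, $xa\le\gamma(xa)$ for $a\in N_\sigma$, $x\in N_\gamma$; it is $\sigma$-structural if $a\gamma m\le\gamma(am)$, $\gamma m\,a\le\gamma(ma)$ for $a\in N_\sigma$, $m\in N$. A Nagata lattice is a residuated $\ell$-semigroup $\mathbf N$ (a lattice with an associative multiplication having residuals $\backslash,/$: $y\le x\backslash z\iff xy\le z\iff x\le z/y$) with a pre-conucleus $\sigma$, a $\sigma$-structural $\sigma$-closure operator $\gamma$, constants $1\in N_\sigma$ and $0\in N_\gamma$, satisfying $\sigma(xy)=\sigma x\sigma y$, $\gamma(xy)=\sigma x\gamma y\vee\gamma x\sigma y$, $\sigma(x\wedge y)=\sigma(\sigma x\wedge\sigma y)$, $\gamma(x\vee y)=\gamma(\gamma x\vee\gamma y)$, $\sigma(x\vee y)=\sigma x\vee\sigma y$, $\gamma(x\wedge y)=\gamma x\wedge\gamma y$, $\sigma(x\backslash y)=\sigma(\sigma x\backslash\sigma y\wedge\gamma x\backslash\gamma y)$, $\sigma(y/x)=\sigma(\sigma y/\sigma x\wedge\gamma y/\gamma x)$, $\sigma x\backslash\gamma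 y=\gamma(x\backslash y)$, $\gamma y/\sigma x=\gamma(y/x)$, $\sigma\gamma x=\sigma(0\backslash\gamma x)=\sigma(\gamma x/0)$, $\gamma\sigma x=\gamma(0\sigma x)=\gamma(\sigma x\,0)$, $1\le\sigma(x\backslash x)$, $1\le\sigma(x/x)$, and the quasi-equations $1\le\sigma(x\backslash y)\Rightarrow x\le y$ and $1\le\sigma(y/x)\Rightarrow x\le y$. A restricted Nagata lattice is a residuated lattice $\mathbf N$ (residuated $\ell$-semigroup with multiplicative unit $1$) with a unital conucleus $\sigma$ (interior operator: isotone, $\sigma\sigma x=\sigma x\le x$; with $\sigma x\sigma y\le\sigma(xy)$ and $\sigma 1=1$), a $\sigma$-structural closure operator $\gamma$ ($x\le\gamma x=\gamma\gamma x$), and a constant $0\in N_\gamma$, satisfying $\sigma(xy)=\sigma x\sigma y$, $xy=\sigma x\,y\vee x\,\sigma y$, $\sigma x\backslash y\wedge x\backslash\gamma y=x\backslash y$, $x/\sigma y\wedge\gamma x/y=x/y$, $\sigma x\backslash\gamma y=\gamma(x\backslash y)$, $\gamma y/\sigma x=\gamma(y/x)$, $\sigma\gamma x=\sigma(0\backslash\gamma x)=\sigma(\gamma x/0)$, $\gamma\sigma x=\gamma(0\sigma x)=\gamma(\sigma x\,0)$. -}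

module Defs where

open import Level using (Level; _⊔_; suc)
open import Data.Product using (Σ; _×_; _,_)
open import Function.Bundles using (_⇔_)
open import Relation.Binary.PropositionalEquality using (_≡_)
open import Relation.Binary.Lattice.Structures using (IsLattice)


record ResLSemigroup (c ℓ : Level) : Set (suc (c ⊔ ℓ)) where
  infixr 7 _·_
  infix  6 _\\_ _/_
  infixr 5 _∨_
  infixr 5 _∧_
  infix  4 _≤_
  field
    Carrier   : Set c
    _≤_       : Carrier → Carrier → Set ℓ
    _∨_ _∧_   : Carrier → Carrier → Carrier
    _·_       : Carrier → Carrier → Carrier
    _\\_ _/_  : Carrier → Carrier → Carrier
    isLattice : IsLattice _≡_ _≤_ _∨_ _∧_
    ·-assoc   : ∀ x y z → (x · y) · z ≡ x · (y · z)
    resˡ      : ∀ x y z → (y ≤ x \\ z) ⇔ (x · y ≤ z)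
    resʳ      : ∀ x y z → (x · y ≤ z) ⇔ (x ≤ z / y)

  _∈Im_ : Carrier → (Carrier → Carrier) → Set c
  z ∈Im f = Σ Carrier (λ w → f w ≡ z)

  Isotone : (Carrier → Carrier) → Set (c ⊔ ℓ)
  Isotone f = ∀ {x y} → x ≤ y → f x ≤ f y

  Idempotent : (Carrier → Carrier) → Set c
  Idempotent f = ∀ x → f (f x) ≡ f x

  IsPreConucleus : (Carrier → Carrier) → Set (c ⊔ ℓ)
  IsPreConucleus σ = Isotone σ × Idempotent σ
    × (∀ a b → a ∈Im σ → b ∈Im σ → (a · b) ∈Im σ)

  IsσClosureOp : (Carrier → Carrier) → (Carrier → Carrier) → Set (c ⊔ ℓ)
  IsσClosureOp σ γ = Isotone γ × Idempotent γ
    × (∀ a x → a ∈Im σ → x ∈Im γ → (a · x ≤ γ (a · x)) × (x · a ≤ γ (x · a)))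

  IsσStructural : (Carrier → Carrier) → (Carrier → Carrier) → Set (c ⊔ ℓ)
  IsσStructural σ γ =
    ∀ a m → a ∈Im σ → (a · γ m ≤ γ (a · m)) × (γ m · a ≤ γ (m · a))

record NagataLattice (c ℓ : Level) : Set (suc (c ⊔ ℓ)) where
  field
    rls : ResLSemigroup c ℓ
  open ResLSemigroup rls public
  field
    σ γ   : Carrier → Carrier
    𝟙 𝟘   : Carrier
    σ-preConucleus : IsPreConucleus σ
    γ-σClosure     : IsσClosureOp σ γ
    γ-σStructural  : IsσStructural σ γ
    𝟙∈Nσ  : 𝟙 ∈Im σ
    𝟘∈Nγ  : 𝟘 ∈Im γ
    ax-σ·   : ∀ x y → σ (x · y) ≡ σ x · σ y
    ax-γ·   : ∀ x y → γ (x · y) ≡ (σ x · γ y) ∨ (γ x · σ y)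
    ax-σ∧   : ∀ x y → σ (x ∧ y) ≡ σ (σ x ∧ σ y)
    ax-γ∨   : ∀ x y → γ (x ∨ y) ≡ γ (γ x ∨ γ y)
    ax-σ∨   : ∀ x y → σ (x ∨ y) ≡ σ x ∨ σ y
    ax-γ∧   : ∀ x y → γ (x ∧ y) ≡ γ x ∧ γ y
    ax-σ\\  : ∀ x y → σ (x \\ y) ≡ σ ((σ x \\ σ y) ∧ (γ x \\ γ y))
    ax-σ/   : ∀ x y → σ (y / x) ≡ σ ((σ y / σ x) ∧ (γ y / γ x))
    ax-γ\\  : ∀ x y → σ x \\ γ y ≡ γ (x \\ y)
    ax-γ/   : ∀ x y → γ y / σ x ≡ γ (y / x)
    ax-σγ₁  : ∀ x → σ (γ x) ≡ σ (𝟘 \\ γ x)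
    ax-σγ₂  : ∀ x → σ (γ x) ≡ σ (γ x / 𝟘)
    ax-γσ₁  : ∀ x → γ (σ x) ≡ γ (𝟘 · σ x)
    ax-γσ₂  : ∀ x → γ (σ x) ≡ γ (σ x · 𝟘)
    ax-1\\  : ∀ x → 𝟙 ≤ σ (x \\ x)
    ax-1/   : ∀ x → 𝟙 ≤ σ (x / x)
    q-\\    : ∀ x y → 𝟙 ≤ σ (x \\ y) → x ≤ y
    q-/     : ∀ x y → 𝟙 ≤ σ (y / x) → x ≤ y

record RestrictedNagataLattice (c ℓ : Level) : Set (suc (c ⊔ ℓ)) where
  field
    rls : ResLSemigroup c ℓ
  open ResLSemigroup rls public
  field
    σ γ   : Carrier → Carrier
    𝟙 𝟘   : Carrier
    ·-identityˡ : ∀ x → 𝟙 · x ≡ x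
    ·-identityʳ : ∀ x → x · 𝟙 ≡ x
    σ-isotone   : Isotone σ
    σ-idem      : Idempotent σ
    σ-deflat    : ∀ x → σ x ≤ x
    σ-mult      : ∀ x y → σ x · σ y ≤ σ (x · y)
    σ-unit      : σ 𝟙 ≡ 𝟙
    γ-isotone   : Isotone γ
    γ-idem      : Idempotent γ
    γ-inflat    : ∀ x → x ≤ γ x
    γ-σStructural : IsσStructural σ γ
    𝟘∈Nγ  : 𝟘 ∈Im γ
    ax-σ·   : ∀ x y → σ (x · y) ≡ σ x · σ y
    ax-·    : ∀ x y → x · y ≡ (σ x · y) ∨ (x · σ y)
    ax-\\   : ∀ x y → (σ x \\ y) ∧ (x \\ γ y) ≡ x \\ y
    ax-/    : ∀ x y → (x / σ y) ∧ (γ x / y) ≡ x / y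
    ax-γ\\  : ∀ x y → σ x \\ γ y ≡ γ (x \\ y)
    ax-γ/   : ∀ x y → γ y / σ x ≡ γ (y / x)
    ax-σγ₁  : ∀ x → σ (γ x) ≡ σ (𝟘 \\ γ x)
    ax-σγ₂  : ∀ x → σ (γ x) ≡ σ (γ x / 𝟘)
    ax-γσ₁  : ∀ x → γ (σ x) ≡ γ (𝟘 · σ x)
    ax-γσ₂  : ∀ x → γ (σ x) ≡ γ (σ x · 𝟘)

{-# OPTIONS --safe #-}
module Submission where

open import Defs
open import Level using (Level)
open import Data.Product using (_×_; _,_; proj₁; proj₂)
open import Function.Bundles using (Equivalence)
open import Relation.Binary.Bundles using (Poset)
open import Relation.Binary.Lattice.Structures using (IsLattice)
open import Relation.Binary.PropositionalEquality using (_≡_; refl; sym; trans; subst)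
import Relation.Binary.Reasoning.PartialOrder as PosetReasoning

-- In both kinds of lattice the residual x \ y is assembled from the pair
-- (σ x \ σ y , γ x \ γ y), resp. (σ x \ y , x \ γ y), as a meet (under σ in the
-- unrestricted case).  The hypotheses put 1 below both meetands, hence 1 below
-- (σ of) x \ y, and this gives x ≤ y by the quasi-equation, resp. by
-- residuation against the unit.

module ResLSemigroupProperties {c ℓ} (R : ResLSemigroup c ℓ) where
  open ResLSemigroup R
  open IsLattice isLattice public
    using (∧-greatest) renaming (refl to ≤-refl; trans to ≤-trans)
  open Equivalence

  poset : Poset c c ℓ
  poset = record { isPartialOrder = IsLattice.isPartialOrder isLattice }

  \\-monoʳ-≤ : ∀ x {y z} → y ≤ z → x \\ y ≤ x \\ z
  \\-monoʳ-≤ x {y} {z} y≤z =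
    from (resˡ x (x \\ y) z) (≤-trans (to (resˡ x (x \\ y) y) ≤-refl) y≤z)

  ∈Im⇒fixed : ∀ {f z} → Idempotent f → z ∈Im f → f z ≡ z
  ∈Im⇒fixed idem (w , refl) = idem w

  module _ {e : Carrier} (·-identityʳ : ∀ x → x · e ≡ x) where

    ≤⇒unit≤\\ : ∀ {x y} → x ≤ y → e ≤ x \\ y
    ≤⇒unit≤\\ {x} {y} x≤y = from (resˡ x e y) (subst (_≤ y) (sym (·-identityʳ x)) x≤y)

    unit≤\\⇒≤ : ∀ {x y} → e ≤ x \\ y → x ≤ y
    unit≤\\⇒≤ {x} {y} e≤x\\y = subst (_≤ y) (·-identityʳ x) (to (resˡ x e y) e≤x\\y)

module NagataLatticeProperties {c ℓ} (N : NagataLattice c ℓ) where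
  open NagataLattice N
  open ResLSemigroupProperties rls
  open PosetReasoning poset

  σ-isotone : Isotone σ
  σ-isotone = proj₁ σ-preConucleus

  σ-idem : Idempotent σ
  σ-idem = proj₁ (proj₂ σ-preConucleus)

  σ𝟙≡𝟙 : σ 𝟙 ≡ 𝟙
  σ𝟙≡𝟙 = ∈Im⇒fixed σ-idem 𝟙∈Nσ

  ≤⇒𝟙≤σ\\ : ∀ {x y} → x ≤ y → 𝟙 ≤ σ (x \\ y)
  ≤⇒𝟙≤σ\\ {x} x≤y = ≤-trans (ax-1\\ x) (σ-isotone (\\-monoʳ-≤ x x≤y))

  σ\\-decomposition : ∀ x y → σ (x \\ y) ≡ σ (σ (σ x \\ σ y) ∧ σ (γ x \\ γ y))
  σ\\-decomposition x y = trans (ax-σ\\ x y) (ax-σ∧ (σ x \\ σ y) (γ x \\ γ y))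

  σγ-reflect-≤ : ∀ x y → σ x ≤ σ y → γ x ≤ γ y → x ≤ y
  σγ-reflect-≤ x y σx≤σy γx≤γy = q-\\ x y (begin
    𝟙                                   ≡⟨ sym σ𝟙≡𝟙 ⟩
    σ 𝟙                                 ≤⟨ σ-isotone (∧-greatest (≤⇒𝟙≤σ\\ σx≤σy) (≤⇒𝟙≤σ\\ γx≤γy)) ⟩
    σ (σ (σ x \\ σ y) ∧ σ (γ x \\ γ y)) ≡⟨ sym (σ\\-decomposition x y) ⟩
    σ (x \\ y)                          ∎)

module RestrictedNagataLatticeProperties {c ℓ} (N : RestrictedNagataLattice c ℓ) where
  open RestrictedNagataLattice N
  open ResLSemigroupProperties rls

  σγ-reflect-≤ : ∀ x y → σ x ≤ σ y → γ x ≤ γ y → x ≤ y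
  σγ-reflect-≤ x y σx≤σy γx≤γy =
    unit≤\\⇒≤ ·-identityʳ (subst (𝟙 ≤_) (ax-\\ x y) (∧-greatest 𝟙≤σx\\y 𝟙≤x\\γy))
    where
    𝟙≤σx\\y : 𝟙 ≤ σ x \\ y
    𝟙≤σx\\y = ≤⇒unit≤\\ ·-identityʳ (≤-trans σx≤σy (σ-deflat y))

    𝟙≤x\\γy : 𝟙 ≤ x \\ γ y
    𝟙≤x\\γy = ≤⇒unit≤\\ ·-identityʳ (≤-trans (γ-inflat x) γx≤γy)

mainTheorem14 : ∀ {c ℓ : Level} →
    ((N : NagataLattice c ℓ) → let open NagataLattice N in
      ∀ x y → σ x ≤ σ y → γ x ≤ γ y → x ≤ y)
    × ((N : RestrictedNagataLattice c ℓ) → let open RestrictedNagataLattice N in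
      ∀ x y → σ x ≤ σ y → γ x ≤ γ y → x ≤ y)
mainTheorem14 =
  NagataLatticeProperties.σγ-reflect-≤ , RestrictedNagataLatticeProperties.σγ-reflect-≤
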